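{- Let $p$ be a prime, $q=p^s$, $a\in\mathbb{Z}_+$, $m$ the smallest nonnegative integer with $a\le p^m$, $r_a=(q-1)p^m$ and $j_{a,\max}=\lfloor (r_a-a)/(q-1)\rfloor$. For $0\le j\le p^m-a$ let $i_j$ be the unique integer with $0\le i_j<q-1$ and $j+i_jp^m\equiv0\pmod{q-1}$. If $\binom{r_a-a}{l(q-1)}\neq0$ in $\mathbb{F}_p$ for some $l$ with $0\le l\le j_{a,\max}$, then there exists $j$ with $0\le j\le p^m-a$ such that $l(q-1)=j+i_jp^m$ and $\binom{p^m-a}{j}\neq0$ in $\mathbb{F}_p$. -}

module Defs where

open import Data.Nat using (ℕ; zero; suc; _<_; _≤_; _^_; _*_; _∸_; _/_)
open import Data.Product using (_×_)
open import Relation.Nullary using (¬_)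

IsLeastExp : ℕ → ℕ → ℕ → Set
IsLeastExp p a m = (a ≤ p ^ m) × (∀ k → k < m → ¬ (a ≤ p ^ k))

-- floor division; the divisor-0 case never arises in the statement
-- (q - 1 ≥ 1 since p ≥ 2 and s ≥ 1) and is set to 0 only to make it total
_div_ : ℕ → ℕ → ℕ
n div zero = 0
n div suc d = n / suc d

rA : (p s m : ℕ) → ℕ
rA p s m = (p ^ s ∸ 1) * p ^ m

jAmax : (p s a m : ℕ) → ℕ
jAmax p s a m = (rA p s m ∸ a) div (p ^ s ∸ 1)

module Submission where

-- Call a row P of Pascal's triangle *p-vanishing* if p divides
-- every interior entry P C u (0 < u < P).  For such a row, a Lucas-type
-- congruence holds for "digits" in base P:
--     (A + B * P) C (j + i * P)  ≡  (A C j) * (B C i)   (mod p)   for A, j < P.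
-- It follows from the two row-shift congruences
--     (n + P) C k ≡ n C k  (k < P),   (n + P) C (k + P) ≡ n C (k + P) + n C k,
-- each proved by induction on n with Pascal's rule.  Row p is p-vanishing for a
-- prime p, and p-vanishing rows are closed under products (by the Lucas
-- congruence itself), hence every row p ^ m is p-vanishing.
-- For the proposition put Q = q - 1, P = p ^ m, N = r_a - a = (P - a) + (Q - 1) * P
-- and k = l * Q ≤ N.  Writing k = j + i * P in base P, the Lucas congruence gives
--     N C k ≡ ((P - a) C j) * ((Q - 1) C i)   (mod p),
-- so p ∤ N C k forces p ∤ (P - a) C j, hence j ≤ P - a; moreover i < Q since k ≤ N < Q * P.

open import Data.Nat
open import Data.Nat.Properties
open import Data.Nat.DivMod hiding (_div_)
open import Data.Nat.Divisibility
open import Data.Nat.Primality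
open import Data.Nat.Combinatorics
  using (_C_; nCn≡1; k>n⇒nCk≡0; nCk+nC[k+1]≡[n+1]C[k+1]; nCk≡n!/k![n-k]!; k![n∸k]!∣n!)
open import Data.Product using (_×_; ∃-syntax; _,_)
open import Data.Sum using (inj₁; inj₂)
open import Function using (_on_)
open import Relation.Nullary using (¬_; contradiction)
open import Relation.Binary.PropositionalEquality
open import Algebra.Properties.CommutativeSemigroup +-commutativeSemigroup using (interchange)
open import Level using (0ℓ)
open import Relation.Binary.Bundles using (Setoid)
import Relation.Binary.Construct.On as On
import Relation.Binary.Reasoning.Setoid as SetoidReasoning
open import Defs

pascal : ∀ n k → n C k + n C suc k ≡ suc n C suc k
pascal = nCk+nC[k+1]≡[n+1]C[k+1]

∤C⇒≤ : ∀ {p n k} → ¬ (p ∣ n C k) → k ≤ n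
∤C⇒≤ {p} p∤nCk = ≮⇒≥ λ n<k → p∤nCk (subst (p ∣_) (sym (k>n⇒nCk≡0 n<k)) (p ∣0))

n∣n! : ∀ n .{{_ : NonZero n}} → n ∣ n !
n∣n! (suc n) = m∣m*n (n !)

binomial-factorisation : ∀ {n k} → k ≤ n → (n C k) * (k ! * (n ∸ k) !) ≡ n !
binomial-factorisation {n} {k} k≤n =
  trans (cong (_* (k ! * (n ∸ k) !)) (nCk≡n!/k![n-k]! k≤n)) (m/n*n≡m {{k !* (n ∸ k) !≢0}} (k![n∸k]!∣n! k≤n))

module Congruence (d : ℕ) .{{_ : NonZero d}} where

  infix 4 _≈_
  _≈_ : ℕ → ℕ → Set
  _≈_ = _≡_ on (_% d)

  -- Addition respects congruence (the only operation the Lucas argument needs).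
  +-cong : ∀ {x x′ y y′} → x ≈ x′ → y ≈ y′ → x + y ≈ x′ + y′
  +-cong {x} {x′} {y} {y′} x≈x′ y≈y′ = begin
    (x + y) % d                ≡⟨ %-distribˡ-+ x y d ⟩
    (x % d + y % d) % d        ≡⟨ cong₂ (λ u v → (u + v) % d) x≈x′ y≈y′ ⟩
    (x′ % d + y′ % d) % d      ≡⟨ %-distribˡ-+ x′ y′ d ⟨
    (x′ + y′) % d              ∎
    where open ≡-Reasoning

  ≡-mod-setoid : Setoid 0ℓ 0ℓ
  ≡-mod-setoid = On.setoid (setoid ℕ) (_% d)

  module ≈-Reasoning = SetoidReasoning ≡-mod-setoid

  ∣⇒≈0 : ∀ {x} → d ∣ x → x ≈ 0
  ∣⇒≈0 {x} d∣x = trans (n∣m⇒m%n≡0 x d d∣x) (sym (n∣m⇒m%n≡0 0 d (d ∣0)))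

  ∣-resp-≈ : ∀ {x y} → x ≈ y → d ∣ y → d ∣ x
  ∣-resp-≈ {x} {y} x≈y d∣y = m%n≡0⇒n∣m x d (trans x≈y (n∣m⇒m%n≡0 y d d∣y))

module BinomialsModulo (p : ℕ) .{{_ : NonZero p}} where

  open Congruence p

  Vanishing : ℕ → Set
  Vanishing P = ∀ u → 0 < u → u < P → p ∣ P C u

  module Lucas (P′ : ℕ) (vanishing : Vanishing (suc P′)) where

    P : ℕ
    P = suc P′

    shift-low : ∀ n k → k < P → (n + P) C k ≈ n C k
    shift-low zero    zero    _   = refl
    shift-low zero    (suc k) k<P = ∣⇒≈0 (vanishing (suc k) (s≤s z≤n) k<P)
    shift-low (suc n) zero    _   = refl
    shift-low (suc n) (suc k) k<P = begin
      suc (n + P) C suc k            ≡⟨ pascal (n + P) k ⟨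
      (n + P) C k + (n + P) C suc k  ≈⟨ +-cong (shift-low n k (<-trans (n<1+n k) k<P))
                                               (shift-low n (suc k) k<P) ⟩
      n C k + n C suc k              ≡⟨ pascal n k ⟩
      suc n C suc k                  ∎
      where open ≈-Reasoning

    shift-high : ∀ n k → (n + P) C (k + P) ≈ n C (k + P) + n C k
    shift-high zero    zero    = cong (_% p) (nCn≡1 P)
    shift-high zero    (suc k) = cong (_% p) (k>n⇒nCk≡0 (s≤s (m≤n+m P k)))
    shift-high (suc n) zero    = begin
      suc (n + P) C suc P′                  ≡⟨ pascal (n + P) P′ ⟨
      (n + P) C P′ + (n + P) C P            ≈⟨ +-cong (shift-low n P′ (n<1+n P′)) (shift-high n zero) ⟩
      n C P′ + (n C P + 1)                  ≡⟨ +-assoc (n C P′) (n C P) 1 ⟨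
      (n C P′ + n C P) + 1                  ≡⟨ cong (_+ 1) (pascal n P′) ⟩
      suc n C P + 1                         ∎
      where open ≈-Reasoning
    shift-high (suc n) (suc k) = begin
      suc (n + P) C suc (k + P)             ≡⟨ pascal (n + P) (k + P) ⟨
      (n + P) C (k + P) + (n + P) C (suc k + P)
                                            ≈⟨ +-cong (shift-high n k) (shift-high n (suc k)) ⟩
      (n C (k + P) + n C k) + (n C (suc k + P) + n C suc k)
                                            ≡⟨ interchange (n C (k + P)) (n C k) (n C (suc k + P)) (n C suc k) ⟩
      (n C (k + P) + n C (suc k + P)) + (n C k + n C suc k)
                                            ≡⟨ cong₂ _+_ (pascal n (k + P)) (pascal n k) ⟩
      suc n C (suc k + P) + suc n C suc k   ∎
      where open ≈-Reasoning

    carry : ∀ x y → x + (P + y * P) ≡ (x + y * P) + P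
    carry x y = trans (cong (x +_) (+-comm P (y * P))) (sym (+-assoc x (y * P) P))

    lucas : ∀ B A j i → A < P → j < P → (A + B * P) C (j + i * P) ≈ (A C j) * (B C i)
    lucas zero    A j zero    _   _   = cong (_% p) (begin
      (A + 0) C (j + 0)  ≡⟨ cong₂ _C_ (+-identityʳ A) (+-identityʳ j) ⟩
      A C j              ≡⟨ *-identityʳ (A C j) ⟨
      (A C j) * 1        ∎)
      where open ≡-Reasoning
    lucas zero    A j (suc i) A<P _   = cong (_% p) (trans (k>n⇒nCk≡0 A+0<j+iP) (sym (*-zeroʳ (A C j))))
      where
      A+0<j+iP : A + 0 < j + (P + i * P)
      A+0<j+iP = <-≤-trans (subst (_< P) (sym (+-identityʳ A)) A<P)
                           (≤-trans (m≤m+n P (i * P)) (m≤n+m (P + i * P) j))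
    lucas (suc B) A j zero    A<P j<P = begin
      (A + (P + B * P)) C (j + 0)   ≡⟨ cong (_C (j + 0)) (carry A B) ⟩
      ((A + B * P) + P) C (j + 0)   ≈⟨ shift-low (A + B * P) (j + 0) (subst (_< P) (sym (+-identityʳ j)) j<P) ⟩
      (A + B * P) C (j + 0 * P)     ≈⟨ lucas B A j zero A<P j<P ⟩
      (A C j) * 1                   ∎
      where open ≈-Reasoning
    lucas (suc B) A j (suc i) A<P j<P = begin
      (A + (P + B * P)) C (j + (P + i * P))
                                    ≡⟨ cong₂ _C_ (carry A B) (carry j i) ⟩
      ((A + B * P) + P) C ((j + i * P) + P)
                                    ≈⟨ shift-high (A + B * P) (j + i * P) ⟩
      (A + B * P) C ((j + i * P) + P) + (A + B * P) C (j + i * P)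
                                    ≡⟨ cong (λ u → (A + B * P) C u + (A + B * P) C (j + i * P)) (sym (carry j i)) ⟩
      (A + B * P) C (j + suc i * P) + (A + B * P) C (j + i * P)
                                    ≈⟨ +-cong (lucas B A j (suc i) A<P j<P) (lucas B A j i A<P j<P) ⟩
      (A C j) * (B C suc i) + (A C j) * (B C i)
                                    ≡⟨ *-distribˡ-+ (A C j) (B C suc i) (B C i) ⟨
      (A C j) * (B C suc i + B C i) ≡⟨ cong ((A C j) *_) (trans (+-comm (B C suc i) (B C i)) (pascal B i)) ⟩
      (A C j) * (suc B C suc i)     ∎
      where open ≈-Reasoning

  vanishing-1 : Vanishing 1
  vanishing-1 (suc u) _ (s≤s ())

  -- Vanishing rows are closed under products: writing u = u₀ + u₁ * P in base P,
  -- Lucas gives (Q * P) C u ≡ (0 C u₀) * (Q C u₁), and one factor is divisible by p.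
  vanishing-* : ∀ {Q P} → Vanishing Q → Vanishing P → Vanishing (Q * P)
  vanishing-* {Q} {zero}   _         _         u _   u<Q*0 = contradiction (subst (u <_) (*-zeroʳ Q) u<Q*0) n≮0
  vanishing-* {Q} {suc P′} vanishingQ vanishingP u 0<u u<QP =
    subst (λ v → p ∣ (Q * P) C v) (sym u≡u₀+u₁P)
      (∣-resp-≈ (lucas Q 0 (u % P) (u / P) z<s (m%n<n u P))
                (factor-vanishes (u % P) (u / P) (subst (0 <_) u≡u₀+u₁P 0<u) (m<n*o⇒m/o<n u<QP)))
    where
    open Lucas P′ vanishingP using (P; lucas)
    u≡u₀+u₁P : u ≡ u % P + u / P * P
    u≡u₀+u₁P = m≡m%n+[m/n]*n u P
    factor-vanishes : ∀ u₀ u₁ → 0 < u₀ + u₁ * P → u₁ < Q → p ∣ (0 C u₀) * (Q C u₁)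
    factor-vanishes zero     (suc u₁) _ u₁<Q = ∣n⇒∣m*n 1 (vanishingQ (suc u₁) z<s u₁<Q)
    factor-vanishes (suc u₀) _        _ _    = p ∣0

  vanishing-^ : ∀ {Q} → Vanishing Q → ∀ m → Vanishing (Q ^ m)
  vanishing-^ vanishingQ zero    = vanishing-1
  vanishing-^ vanishingQ (suc m) = vanishing-* vanishingQ (vanishing-^ vanishingQ m)

  prime∤! : Prime p → ∀ x → x < p → ¬ (p ∣ x !)
  prime∤! pp zero    _   p∣1  = <⇒≢ (nonTrivial⇒n>1 p {{prime⇒nonTrivial pp}}) (sym (∣1⇒≡1 p∣1))
  prime∤! pp (suc x) x<p p∣x! with euclidsLemma (suc x) (x !) pp p∣x!
  ... | inj₁ p∣1+x = <⇒≱ x<p (∣⇒≤ p∣1+x)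
  ... | inj₂ p∣x!  = prime∤! pp x (<-trans (n<1+n x) x<p) p∣x!

  -- Row p vanishes: p ∣ p! = (p C u) * (u! * (p ∸ u)!) while p divides neither u! nor (p ∸ u)!.
  prime-vanishing : Prime p → Vanishing p
  prime-vanishing pp u 0<u u<p
    with euclidsLemma (p C u) (u ! * (p ∸ u) !) pp (subst (p ∣_) (sym (binomial-factorisation (<⇒≤ u<p))) (n∣n! p))
  ... | inj₁ p∣pCu = p∣pCu
  ... | inj₂ p∣u!*[p∸u]! with euclidsLemma (u !) ((p ∸ u) !) pp p∣u!*[p∸u]!
  ...   | inj₁ p∣u!     = contradiction p∣u! (prime∤! pp u u<p)
  ...   | inj₂ p∣[p∸u]! = contradiction p∣[p∸u]! (prime∤! pp (p ∸ u) (∸-monoʳ-< 0<u (<⇒≤ u<p)))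

  base-P-digits : ∀ Q P a l → Vanishing P → 1 ≤ Q → 1 ≤ a → a ≤ P
    → l ≤ (Q * P ∸ a) div Q
    → ¬ (p ∣ ((Q * P ∸ a) C (l * Q)))
    → ∃[ j ] ∃[ i ] (j ≤ P ∸ a × i < Q × Q ∣ (j + i * P)
        × l * Q ≡ j + i * P × ¬ (p ∣ ((P ∸ a) C j)))
  base-P-digits zero     _        _        _ _ ()  _  _  _ _
  base-P-digits _        _        zero     _ _ _   () _  _ _
  base-P-digits _        zero     (suc _)  _ _ _   _  () _ _
  base-P-digits (suc Q′) (suc P′) (suc a′) l vanishingP _ _ a≤P l≤N/Q p∤NCk =
    j , i , ∤C⇒≤ p∤[P∸a]Cj , i<Q , subst (Q ∣_) k≡j+iP (n∣m*n l) , k≡j+iP , p∤[P∸a]Cj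
    where
    open Lucas P′ vanishingP using (P; lucas)
    Q a N k j i : ℕ
    Q = suc Q′
    a = suc a′
    N = Q * P ∸ a
    k = l * Q
    j = k % P
    i = k / P

    k≡j+iP : k ≡ j + i * P
    k≡j+iP = m≡m%n+[m/n]*n k P

    N≡[P∸a]+Q′P : N ≡ (P ∸ a) + Q′ * P
    N≡[P∸a]+Q′P = +-∸-comm (Q′ * P) a≤P

    P∸a<P : P ∸ a < P
    P∸a<P = s≤s (m∸n≤m P′ a′)

    i<Q : i < Q
    i<Q = m<n*o⇒m/o<n (begin-strict
      k                  ≤⟨ *-monoˡ-≤ Q l≤N/Q ⟩
      N / Q * Q          ≤⟨ m/n*n≤m N Q ⟩
      N                  ≡⟨ N≡[P∸a]+Q′P ⟩
      (P ∸ a) + Q′ * P   <⟨ +-monoˡ-< (Q′ * P) P∸a<P ⟩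
      Q * P              ∎)
      where open ≤-Reasoning

    NCk≈ : N C k ≈ ((P ∸ a) C j) * (Q′ C i)
    NCk≈ = begin
      N C k                            ≡⟨ cong₂ _C_ N≡[P∸a]+Q′P k≡j+iP ⟩
      ((P ∸ a) + Q′ * P) C (j + i * P) ≈⟨ lucas Q′ (P ∸ a) j i P∸a<P (m%n<n k P) ⟩
      ((P ∸ a) C j) * (Q′ C i)         ∎
      where open ≈-Reasoning

    p∤[P∸a]Cj : ¬ (p ∣ (P ∸ a) C j)
    p∤[P∸a]Cj p∣[P∸a]Cj = p∤NCk (∣-resp-≈ NCk≈ (∣m⇒∣m*n (Q′ C i) p∣[P∸a]Cj))

-- The proposition: take Q = q ∸ 1 ≥ 1 and the vanishing row P = p ^ m.
proposition5p18 : (p s a m l : ℕ) → Prime p → 1 ≤ s → 1 ≤ a → IsLeastExp p a m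
    → l ≤ jAmax p s a m
    → ¬ (p ∣ ((rA p s m ∸ a) C (l * (p ^ s ∸ 1))))
    → ∃[ j ] ∃[ i ] (j ≤ p ^ m ∸ a × i < p ^ s ∸ 1 × (p ^ s ∸ 1) ∣ (j + i * p ^ m)
        × l * (p ^ s ∸ 1) ≡ j + i * p ^ m × ¬ (p ∣ ((p ^ m ∸ a) C j)))
proposition5p18 p (suc s) a m l pp _ 1≤a (a≤pᵐ , _) l≤jmax p∤ =
  base-P-digits (p ^ suc s ∸ 1) (p ^ m) a l (vanishing-^ (prime-vanishing pp) m) 1≤q∸1 1≤a a≤pᵐ l≤jmax p∤
  where
  instance
    p≢0 : NonZero p
    p≢0 = prime⇒nonZero pp
  open BinomialsModulo p

  -- q = p * p ^ s ≥ p ≥ 2.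
  1≤q∸1 : 1 ≤ p ^ suc s ∸ 1
  1≤q∸1 = ∸-monoˡ-≤ 1 (≤-trans (nonTrivial⇒n>1 p {{prime⇒nonTrivial pp}}) (m≤m*n p (p ^ s) {{m^n≢0 p s}}))
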